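{- If two posets $P$ and $Q$ on $n$ elements satisfy $U_P=U_Q$, then for every $k\in[n]$ they have the same number of chains of length $k$. Accordingly, their longest chains have the same length.
   Context: A chain of length $k$ in $P$ is a sequence $x_1<_Px_2<_P\dots<_Px_k$ of $k$ elements. For a digraph $X=(V,E)$ with $|V|=n$, a $V$-listing is a bijection $\pi:[n]\to V$, and $X\mathrm{Des}(\pi)=\{i\in[n-1]:(\pi_i,\pi_{i+1})\in E\}$. Let $F_I=\sum_{i_1\le\dots\le i_n,\ i_j<i_{j+1}\ (j\in I)}x_{i_1}\cdots x_{i_n}$, and $U_X=\sum_\pi F_{X\mathrm{Des}(\pi)}$ over all $V$-listings. For a poset $P$, $U_P:=U_{D_P}$, where $D_P$ is the digraph on the elements of $P$ with edges $(i,j)$ for all $i<_Pj$. -}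

module Defs where

open import Level using (0ℓ)
open import Data.Nat using (ℕ; zero; suc; _+_; _≤_; _<_) renaming (_<?_ to _<ℕ?_; _≤?_ to _≤ℕ?_)
open import Data.Fin using (Fin)
open import Data.Fin.Properties as FinP using ()
open import Data.List using (List; []; _∷_; length; filter; map; concatMap; allFin)
open import Data.Nat.ListAction using (sum)
open import Data.List.Relation.Unary.Unique.Propositional using (Unique)
import Data.List.Relation.Unary.Unique.DecPropositional as UDec
open import Data.Bool using (Bool; true; false; _∧_; if_then_else_)
open import Data.Product using (_×_; ∃-syntax)
open import Relation.Binary using (Rel; IsStrictPartialOrder; Decidable)
open import Relation.Binary.PropositionalEquality using (_≡_)
open import Relation.Nullary using (¬_)
open import Relation.Nullary.Decidable using (⌊_⌋)

-- A (finite) poset on n elements: the ground set is Fin n, given by its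
-- strict order relation _<P_, which is a strict partial order and is
-- decidable (automatic for finite posets classically; needed for counting).

record Poset (n : ℕ) : Set₁ where
  field
    _<P_   : Rel (Fin n) 0ℓ
    isSPO  : IsStrictPartialOrder _≡_ _<P_
    _<P?_  : Decidable _<P_
open Poset public

count : {A : Set} → (A → Bool) → List A → ℕ
count p []       = 0
count p (x ∷ xs) = (if p x then 1 else 0) + count p xs

allLists : (n m : ℕ) → List (List (Fin n))
allLists n zero    = [] ∷ []
allLists n (suc m) = concatMap (λ x → map (x ∷_) (allLists n m)) (allFin n)

-- V-listings: bijections [n] → V, i.e. lists of length n of pairwise
-- distinct elements of Fin n.

listings : (n : ℕ) → List (List (Fin n))
listings n = filter (λ l → UDec.unique? (FinP._≟_ {n}) l) (allLists n n)

-- Descent set of a listing w.r.t. the digraph D_P (edge (a,b) iff a <P b):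
-- represented as the list of length n-1 of booleans, position j being
-- true iff (π_j, π_{j+1}) is an edge, i.e. π_j <P π_{j+1}.

XDes : {n : ℕ} → Poset n → List (Fin n) → List Bool
XDes P []           = []
XDes P (x ∷ [])     = []
XDes P (x ∷ y ∷ xs) = ⌊ _<P?_ P x y ⌋ ∷ XDes P (y ∷ xs)

-- Monomials of degree n in x_1, x_2, ... are in bijection with weakly
-- increasing index sequences i_1 ≤ ... ≤ i_n (the monomial x_{i_1}⋯x_{i_n}).

WeaklyIncreasing : List ℕ → Set
WeaklyIncreasing []           = Data.Unit.⊤ where import Data.Unit
WeaklyIncreasing (a ∷ [])     = Data.Unit.⊤ where import Data.Unit
WeaklyIncreasing (a ∷ b ∷ is) = a ≤ b × WeaklyIncreasing (b ∷ is)

-- Coefficient of the monomial x_{i_1}⋯x_{i_n} (i weakly increasing) in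
-- the fundamental quasisymmetric function F_I: it is 1 iff i_j < i_{j+1}
-- for every j ∈ I, and 0 otherwise.
FCoeff : List Bool → List ℕ → ℕ
FCoeff (true  ∷ I) (a ∷ b ∷ is) = if ⌊ a <ℕ? b ⌋ then FCoeff I (b ∷ is) else 0
FCoeff (false ∷ I) (a ∷ b ∷ is) = FCoeff I (b ∷ is)
FCoeff _           _            = 1

-- Coefficient of the monomial x_{i_1}⋯x_{i_n} in U_P = Σ_π F_{XDes(π)}.
UCoeff : {n : ℕ} → Poset n → List ℕ → ℕ
UCoeff {n} P i = sum (map (λ π → FCoeff (XDes P π) i) (listings n))

-- U_P = U_Q as formal power series: all coefficients agree.  Both are
-- homogeneous of degree n, so it suffices (and is necessary) to compare
-- coefficients of degree-n monomials.
SameU : {n : ℕ} → Poset n → Poset n → Set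
SameU {n} P Q = (i : List ℕ) → length i ≡ n → WeaklyIncreasing i →
                UCoeff P i ≡ UCoeff Q i

isChain : {n : ℕ} → Poset n → List (Fin n) → Bool
isChain P []           = true
isChain P (x ∷ [])     = true
isChain P (x ∷ y ∷ xs) = ⌊ _<P?_ P x y ⌋ ∧ isChain P (y ∷ xs)

chainCount : {n : ℕ} → Poset n → ℕ → ℕ
chainCount {n} P k = count (isChain P) (allLists n k)

HasChain : {n : ℕ} → Poset n → ℕ → Set
HasChain {n} P k = ∃[ c ] (length c ≡ k × isChain P c ≡ true)

LongestChainLength : {n : ℕ} → Poset n → ℕ → Set
LongestChainLength P k = HasChain P k × ((m : ℕ) → k < m → ¬ HasChain P m)

{-# OPTIONS --safe #-}
-- The coefficient of x_{i_1}⋯x_{i_n} in F_I is 1 exactly when I ⊆ {j : i_j < i_{j+1}}, so the coefficients of U_P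
-- count the listings whose descent set avoids a prescribed set of positions. Marking each position as required,
-- forbidden or free, the counts satisfy required + forbidden = free; eliminating required positions one at a time
-- shows that U_P determines the number of listings matching every such pattern. The first k − 1 positions of a
-- listing are all descents exactly when its first k entries form a chain, so c_k(P) · (n − k)! listings match the
-- pattern with k − 1 leading required positions, and c_k(P) is recovered by cancelling (n − k)!. Longest chains
-- are then determined by which c_k vanish.
module Submission where

open import Defs
open import Data.Nat using (ℕ; zero; suc; _+_; _*_; _∸_; _!; _≤_; _<_; _<?_; z≤n; s≤s)
open import Data.Nat.Properties
  using ( _≟_; +-*-semiring; +-identityʳ; +-assoc; +-cancelˡ-≡; +-cancelʳ-≡
        ; *-identityʳ; *-zeroʳ; *-distribˡ-+; *-cancelʳ-≡; _!≢0
        ; ≤-refl; ≤-reflexive; ≤-trans; m≤m+n; m≤n+m; n<1+n; n≮n; m<n⇒n≢0; suc-injective; m+[n∸m]≡n)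
open import Data.Nat.ListAction using (sum)
open import Data.Nat.ListAction.Properties using (sum-++)
open import Data.Fin using (Fin; zero; suc; punchIn)
open import Data.Fin.Properties using (punchInᵢ≢i) renaming (_≟_ to _≟ᶠ_)
open import Data.Bool using (Bool; true; false; not; _∧_; if_then_else_)
open import Data.Product using (_×_; _,_; ∃-syntax)
open import Data.Unit using (tt)
open import Data.List using (List; []; _∷_; [_]; _++_; length; map; concatMap; allFin; tabulate; replicate; filter)
open import Data.List.Properties
  using (length-map; length-++; length-replicate; map-++; map-∘; map-tabulate; ++-assoc; ++-identityʳ)
open import Data.List.Membership.Propositional using (_∉_)
import Data.List.Membership.DecPropositional as DecMembership
open import Data.List.Relation.Unary.Any using (here; there)
open import Data.List.Relation.Unary.All as All using ([]; _∷_)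
open import Data.List.Relation.Unary.All.Properties using (++⁻ʳ)
import Data.List.Relation.Unary.AllPairs as AllPairs
open import Data.List.Relation.Unary.Linked using (Linked; []; [-]; _∷_)
open import Data.List.Relation.Unary.Linked.Properties using (Linked⇒AllPairs)
open import Data.List.Relation.Unary.Unique.Propositional using (Unique; []; _∷_)
open import Data.List.Relation.Unary.Unique.Propositional.Properties using (++⁺; Unique[x∷xs]⇒x∉xs)
import Data.List.Relation.Unary.Unique.DecPropositional as UniqueDec
open import Function using (_∘_)
open import Relation.Binary using (IsStrictPartialOrder)
open import Relation.Binary.PropositionalEquality
  using (_≡_; _≢_; refl; sym; trans; cong; cong₂; subst; module ≡-Reasoning)
open import Relation.Nullary using (Dec; yes; no; does; contradiction)
open import Relation.Nullary.Decidable using (⌊_⌋; dec-true; dec-false; ¬?)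
open import Relation.Unary using (Pred; Decidable)
open import Algebra.Properties.Semiring.Sum +-*-semiring
  using (sum-syntax; sum-cong-≗; sum-remove; sum-replicate-zero; ∑-distrib-+; *-distribʳ-sum)
  renaming (sum to ∑)

open ≡-Reasoning

toℕ : Bool → ℕ
toℕ b = if b then 1 else 0

𝟙 : ∀ {ℓ} {A : Set ℓ} → Dec A → ℕ
𝟙 a? = toℕ (does a?)

𝟙+𝟙¬≡1 : ∀ {ℓ} {A : Set ℓ} (a? : Dec A) → 𝟙 a? + 𝟙 (¬? a?) ≡ 1
𝟙+𝟙¬≡1 (yes _) = refl
𝟙+𝟙¬≡1 (no _)  = refl

toℕ≢0⇒true : ∀ {b} → toℕ b ≢ 0 → b ≡ true
toℕ≢0⇒true {true}  _   = refl
toℕ≢0⇒true {false} ≢0 = contradiction refl ≢0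

count≡sum-map : ∀ {A : Set} (p : A → Bool) xs → count p xs ≡ sum (map (toℕ ∘ p) xs)
count≡sum-map p []       = refl
count≡sum-map p (x ∷ xs) = cong (toℕ (p x) +_) (count≡sum-map p xs)

sum-map-filter : ∀ {A : Set} {ℓ} {P : Pred A ℓ} (P? : Decidable P) (f : A → ℕ) xs →
                 sum (map f (filter P? xs)) ≡ sum (map (λ x → 𝟙 (P? x) * f x) xs)
sum-map-filter P? f []       = refl
sum-map-filter P? f (x ∷ xs) with does (P? x)
... | true  = cong₂ _+_ (sym (+-identityʳ (f x))) (sum-map-filter P? f xs)
... | false = sum-map-filter P? f xs

sum-map-concatMap : ∀ {A B : Set} (f : B → ℕ) (g : A → List B) xs →
                    sum (map f (concatMap g xs)) ≡ sum (map (λ x → sum (map f (g x))) xs)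
sum-map-concatMap f g []       = refl
sum-map-concatMap f g (x ∷ xs) = begin
  sum (map f (g x ++ concatMap g xs))             ≡⟨ cong sum (map-++ f (g x) _) ⟩
  sum (map f (g x) ++ map f (concatMap g xs))     ≡⟨ sum-++ (map f (g x)) _ ⟩
  sum (map f (g x)) + sum (map f (concatMap g xs)) ≡⟨ cong (sum (map f (g x)) +_) (sum-map-concatMap f g xs) ⟩
  sum (map f (g x)) + sum (map (λ y → sum (map f (g y))) xs) ∎

sum-tabulate : ∀ {n} (f : Fin n → ℕ) → sum (tabulate f) ≡ ∑ f
sum-tabulate {zero}  f = refl
sum-tabulate {suc n} f = cong (f zero +_) (sum-tabulate (f ∘ suc))

sum-map-allFin : ∀ {n} (f : Fin n → ℕ) → sum (map f (allFin n)) ≡ ∑ f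
sum-map-allFin f = trans (cong sum (map-tabulate (λ i → i) f)) (sum-tabulate f)

∑-ones : ∀ n → ∑[ i < n ] 1 ≡ n
∑-ones zero    = refl
∑-ones (suc n) = cong suc (∑-ones n)

≤-∑ : ∀ {n} (f : Fin n → ℕ) i → f i ≤ ∑ f
≤-∑ {suc n} f i = ≤-trans (m≤m+n (f i) _) (≤-reflexive (sym (sum-remove {i = i} f)))

∑≢0⇒∃≢0 : ∀ {n} (f : Fin n → ℕ) → ∑ f ≢ 0 → ∃[ i ] f i ≢ 0
∑≢0⇒∃≢0 {zero}  f ∑≢0 = contradiction refl ∑≢0
∑≢0⇒∃≢0 {suc n} f ∑≢0 with f zero ≟ 0
... | no f₀≢0  = zero , f₀≢0
... | yes f₀≡0 with ∑≢0⇒∃≢0 (f ∘ suc) (∑≢0 ∘ cong₂ _+_ f₀≡0)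
...   | i , fᵢ≢0 = suc i , fᵢ≢0

∑-δ : ∀ {n} (y : Fin n) → ∑[ x < n ] 𝟙 (x ≟ᶠ y) ≡ 1
∑-δ {suc n} y = begin
  ∑[ x < suc n ] 𝟙 (x ≟ᶠ y)                   ≡⟨ sum-remove {i = y} (λ x → 𝟙 (x ≟ᶠ y)) ⟩
  𝟙 (y ≟ᶠ y) + ∑[ j < n ] 𝟙 (punchIn y j ≟ᶠ y) ≡⟨ cong₂ _+_ (cong toℕ (dec-true (y ≟ᶠ y) refl)) offDiagonal ⟩
  1                                            ∎
  where
  offDiagonal : ∑[ j < n ] 𝟙 (punchIn y j ≟ᶠ y) ≡ 0
  offDiagonal = trans (sum-cong-≗ (λ j → cong toℕ (dec-false (punchIn y j ≟ᶠ y) (punchInᵢ≢i y j))))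
                      (sum-replicate-zero n)

sumLists : (n k : ℕ) → (List (Fin n) → ℕ) → ℕ
sumLists n zero    f = f []
sumLists n (suc k) f = ∑[ x < n ] sumLists n k (λ c → f (x ∷ c))

module _ {n : ℕ} where

  sumLists-cong : ∀ k {f g : List (Fin n) → ℕ} → (∀ c → length c ≡ k → f c ≡ g c) →
                  sumLists n k f ≡ sumLists n k g
  sumLists-cong zero    f≗g = f≗g [] refl
  sumLists-cong (suc k) f≗g = sum-cong-≗ (λ x → sumLists-cong k (λ c len → f≗g (x ∷ c) (cong suc len)))

  sumLists-zero : ∀ k → sumLists n k (λ _ → 0) ≡ 0
  sumLists-zero zero    = refl
  sumLists-zero (suc k) = begin
    ∑[ x < n ] sumLists n k (λ _ → 0) ≡⟨ sum-cong-≗ {n} (λ _ → sumLists-zero k) ⟩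
    ∑[ x < n ] 0                      ≡⟨ sum-replicate-zero n ⟩
    0                                 ∎

  sumLists-distrib-+ : ∀ k (f g : List (Fin n) → ℕ) →
                       sumLists n k (λ c → f c + g c) ≡ sumLists n k f + sumLists n k g
  sumLists-distrib-+ zero    f g = refl
  sumLists-distrib-+ (suc k) f g =
    trans (sum-cong-≗ (λ x → sumLists-distrib-+ k (f ∘ (x ∷_)) (g ∘ (x ∷_))))
          (∑-distrib-+ (λ x → sumLists n k (f ∘ (x ∷_))) (λ x → sumLists n k (g ∘ (x ∷_))))

  *-distribʳ-sumLists : ∀ k (f : List (Fin n) → ℕ) a → sumLists n k f * a ≡ sumLists n k (λ c → f c * a)
  *-distribʳ-sumLists zero    f a = refl
  *-distribʳ-sumLists (suc k) f a =
    trans (*-distribʳ-sum a (λ x → sumLists n k (f ∘ (x ∷_))))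
          (sum-cong-≗ (λ x → *-distribʳ-sumLists k (f ∘ (x ∷_)) a))

  sumLists-++ : ∀ k m (f : List (Fin n) → ℕ) →
                sumLists n (k + m) f ≡ sumLists n k (λ c → sumLists n m (λ r → f (c ++ r)))
  sumLists-++ zero    m f = refl
  sumLists-++ (suc k) m f = sum-cong-≗ (λ x → sumLists-++ k m (f ∘ (x ∷_)))

  ≤-sumLists : ∀ (f : List (Fin n) → ℕ) c → f c ≤ sumLists n (length c) f
  ≤-sumLists f []      = ≤-refl
  ≤-sumLists f (x ∷ c) = ≤-trans (≤-sumLists (f ∘ (x ∷_)) c) (≤-∑ _ x)

  sumLists≢0⇒∃≢0 : ∀ k (f : List (Fin n) → ℕ) → sumLists n k f ≢ 0 → ∃[ c ] (length c ≡ k × f c ≢ 0)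
  sumLists≢0⇒∃≢0 zero    f ≢0 = [] , refl , ≢0
  sumLists≢0⇒∃≢0 (suc k) f ≢0 with ∑≢0⇒∃≢0 _ ≢0
  ... | x , ≢0ₓ with sumLists≢0⇒∃≢0 k (f ∘ (x ∷_)) ≢0ₓ
  ...   | c , len , fxc≢0 = x ∷ c , cong suc len , fxc≢0

  sum-map-allLists : ∀ k (f : List (Fin n) → ℕ) → sum (map f (allLists n k)) ≡ sumLists n k f
  sum-map-allLists zero    f = +-identityʳ (f [])
  sum-map-allLists (suc k) f = begin
    sum (map f (concatMap (λ x → map (x ∷_) (allLists n k)) (allFin n)))
      ≡⟨ sum-map-concatMap f _ (allFin n) ⟩
    sum (map (λ x → sum (map f (map (x ∷_) (allLists n k)))) (allFin n))
      ≡⟨ sum-map-allFin (λ x → sum (map f (map (x ∷_) (allLists n k)))) ⟩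
    ∑[ x < n ] sum (map f (map (x ∷_) (allLists n k)))
      ≡⟨ sum-cong-≗ (λ x → trans (cong sum (sym (map-∘ (allLists n k)))) (sum-map-allLists k (f ∘ (x ∷_)))) ⟩
    sumLists n (suc k) f ∎

module _ {n : ℕ} where

  open DecMembership (_≟ᶠ_ {n}) using (_∈?_; _∉?_)

  unique? : (π : List (Fin n)) → Dec (Unique π)
  unique? = UniqueDec.unique? _≟ᶠ_

  sum-map-listings : ∀ (f : List (Fin n) → ℕ) → sum (map f (listings n)) ≡ sumLists n n (λ π → 𝟙 (unique? π) * f π)
  sum-map-listings f = trans (sum-map-filter unique? f (allLists n n)) (sum-map-allLists n _)

  𝟙-∈-∷ : ∀ {y c} → y ∉ c → ∀ x → 𝟙 (x ∈? y ∷ c) ≡ 𝟙 (x ≟ᶠ y) + 𝟙 (x ∈? c)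
  𝟙-∈-∷ {y} {c} y∉c x with x ≟ᶠ y
  ... | yes refl = cong (suc ∘ toℕ) (sym (dec-false (x ∈? c) y∉c))
  ... | no _     = refl

  ∑∈≡length : ∀ c → Unique c → ∑[ x < n ] 𝟙 (x ∈? c) ≡ length c
  ∑∈≡length []      _  = sum-replicate-zero n
  ∑∈≡length (y ∷ c) uc = begin
    ∑[ x < n ] 𝟙 (x ∈? y ∷ c)                       ≡⟨ sum-cong-≗ (𝟙-∈-∷ (Unique[x∷xs]⇒x∉xs uc)) ⟩
    ∑[ x < n ] (𝟙 (x ≟ᶠ y) + 𝟙 (x ∈? c))            ≡⟨ ∑-distrib-+ (λ x → 𝟙 (x ≟ᶠ y)) (λ x → 𝟙 (x ∈? c)) ⟩
    ∑[ x < n ] 𝟙 (x ≟ᶠ y) + ∑[ x < n ] 𝟙 (x ∈? c)   ≡⟨ cong₂ _+_ (∑-δ y) (∑∈≡length c (AllPairs.tail uc)) ⟩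
    suc (length c)                                  ∎

  length+∑∉≡n : ∀ c → Unique c → length c + ∑[ x < n ] 𝟙 (x ∉? c) ≡ n
  length+∑∉≡n c uc = begin
    length c + ∑[ x < n ] 𝟙 (x ∉? c)                ≡⟨ cong (_+ ∑[ x < n ] 𝟙 (x ∉? c)) (∑∈≡length c uc) ⟨
    ∑[ x < n ] 𝟙 (x ∈? c) + ∑[ x < n ] 𝟙 (x ∉? c)   ≡⟨ ∑-distrib-+ (λ x → 𝟙 (x ∈? c)) (λ x → 𝟙 (x ∉? c)) ⟨
    ∑[ x < n ] (𝟙 (x ∈? c) + 𝟙 (x ∉? c))            ≡⟨ sum-cong-≗ (λ x → 𝟙+𝟙¬≡1 (x ∈? c)) ⟩
    ∑[ x < n ] 1                                    ≡⟨ ∑-ones n ⟩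
    n                                               ∎

  Unique⇒length≤n : ∀ {c} → Unique c → length c ≤ n
  Unique⇒length≤n {c} uc = subst (length c ≤_) (length+∑∉≡n c uc) (m≤m+n _ _)

  Unique-∷ʳ : ∀ {c : List (Fin n)} {x} → Unique c → x ∉ c → Unique (c ++ [ x ])
  Unique-∷ʳ uc x∉c = ++⁺ uc ([] ∷ []) λ { (x∈c , here refl) → x∉c x∈c }

  Unique[xs++y∷ys]⇒y∉xs : ∀ (c : List (Fin n)) {y r} → Unique (c ++ y ∷ r) → y ∉ c
  Unique[xs++y∷ys]⇒y∉xs (x ∷ c) (x≢ ∷ _) (here y≡x)  = All.head (++⁻ʳ c x≢) (sym y≡x)
  Unique[xs++y∷ys]⇒y∉xs (x ∷ c) (_ ∷ u)  (there y∈c) = Unique[xs++y∷ys]⇒y∉xs c u y∈c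

  completions : List (Fin n) → ℕ → ℕ
  completions c m = sumLists n m (λ r → 𝟙 (unique? (c ++ r)))

  completions-unique : ∀ m c → Unique c → length c + m ≡ n → completions c m ≡ m !
  completions-unique zero    c uc _   =
    cong toℕ (dec-true (unique? (c ++ [])) (subst Unique (sym (++-identityʳ c)) uc))
  completions-unique (suc m) c uc len = begin
    completions c (suc m)          ≡⟨ sum-cong-≗ (λ x → extend (x ∉? c)) ⟩
    ∑[ x < n ] (𝟙 (x ∉? c) * m !)  ≡⟨ *-distribʳ-sum (m !) (λ x → 𝟙 (x ∉? c)) ⟨
    ∑[ x < n ] 𝟙 (x ∉? c) * m !    ≡⟨ cong (_* m !) (+-cancelˡ-≡ (length c) _ _ (trans (length+∑∉≡n c uc) (sym len))) ⟩
    suc m * m !                    ∎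
    where
    extend : ∀ {x} (x∉?c : Dec (x ∉ c)) → sumLists n m (λ r → 𝟙 (unique? (c ++ x ∷ r))) ≡ 𝟙 x∉?c * m !
    extend {x} (yes x∉c) = begin
      sumLists n m (λ r → 𝟙 (unique? (c ++ x ∷ r)))
        ≡⟨ sumLists-cong m (λ r _ → cong (𝟙 ∘ unique?) (sym (++-assoc c [ x ] r))) ⟩
      completions (c ++ [ x ]) m
        ≡⟨ completions-unique m (c ++ [ x ]) (Unique-∷ʳ uc x∉c)
             (trans (cong (_+ m) (length-++ c)) (trans (+-assoc (length c) 1 m) len)) ⟩
      m !
        ≡⟨ +-identityʳ (m !) ⟨
      1 * m ! ∎
    extend {x} (no x∈c) = trans (sumLists-cong m λ r _ →
                            cong toℕ (dec-false (unique? (c ++ x ∷ r)) (x∈c ∘ Unique[xs++y∷ys]⇒y∉xs c)))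
                         (sumLists-zero m)

-- Descent patterns

data Mark : Set where
  required forbidden free : Mark

admits : Mark → Bool → Bool
admits required  b = b
admits forbidden b = not b
admits free      _ = true

-- A descent set is read as padded with `false`s, a pattern as padded with `free`s.
matches : List Bool → List Mark → Bool
matches d       []       = true
matches []      (p ∷ ps) = admits p false ∧ matches [] ps
matches (b ∷ d) (p ∷ ps) = admits p b ∧ matches d ps

toℕ-∧-+ : ∀ a {x y z} → toℕ x + toℕ y ≡ toℕ z → toℕ (a ∧ x) + toℕ (a ∧ y) ≡ toℕ (a ∧ z)
toℕ-∧-+ true  eq = eq
toℕ-∧-+ false _  = refl

matches-split : ∀ d A B →
  toℕ (matches d (A ++ required ∷ B)) + toℕ (matches d (A ++ forbidden ∷ B)) ≡ toℕ (matches d (A ++ free ∷ B))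
matches-split []          []      B = refl
matches-split (true ∷ d)  []      B = +-identityʳ _
matches-split (false ∷ d) []      B = refl
matches-split []          (p ∷ A) B = toℕ-∧-+ (admits p false) (matches-split [] A B)
matches-split (b ∷ d)     (p ∷ A) B = toℕ-∧-+ (admits p b) (matches-split d A B)

matches-frees : ∀ d m → matches d (replicate m free) ≡ true
matches-frees d       zero    = refl
matches-frees []      (suc m) = matches-frees [] m
matches-frees (b ∷ d) (suc m) = matches-frees d m

matches-++-frees : ∀ d ps m → matches d (ps ++ replicate m free) ≡ matches d ps
matches-++-frees d       []       m = matches-frees d m
matches-++-frees []      (p ∷ ps) m = cong (admits p false ∧_) (matches-++-frees [] ps m)
matches-++-frees (b ∷ d) (p ∷ ps) m = cong (admits p b ∧_) (matches-++-frees d ps m)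

module _ {n : ℕ} (P : Poset n) where

  countMatching : List Mark → ℕ
  countMatching ps = sumLists n n (λ π → 𝟙 (unique? π) * toℕ (matches (XDes P π) ps))

  countMatching-split : ∀ A B →
    countMatching (A ++ required ∷ B) + countMatching (A ++ forbidden ∷ B) ≡ countMatching (A ++ free ∷ B)
  countMatching-split A B = trans (sym (sumLists-distrib-+ n _ _)) (sumLists-cong n λ π _ →
    trans (sym (*-distribˡ-+ (𝟙 (unique? π)) _ _)) (cong (𝟙 (unique? π) *_) (matches-split (XDes P π) A B)))

-- Monomials rising at prescribed positions

toMark : Bool → Mark
toMark true  = free
toMark false = forbidden

partialSums : ℕ → List Bool → List ℕ
partialSums a []      = []
partialSums a (b ∷ A) = toℕ b + a ∷ partialSums (toℕ b + a) A

monomialRisingAt : List Bool → List ℕ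
monomialRisingAt A = 0 ∷ partialSums 0 A

length-partialSums : ∀ a A → length (partialSums a A) ≡ length A
length-partialSums a []      = refl
length-partialSums a (b ∷ A) = cong suc (length-partialSums (toℕ b + a) A)

partialSums-weaklyIncreasing : ∀ a A → WeaklyIncreasing (a ∷ partialSums a A)
partialSums-weaklyIncreasing a []      = tt
partialSums-weaklyIncreasing a (b ∷ A) = m≤n+m a (toℕ b) , partialSums-weaklyIncreasing (toℕ b + a) A

matches-[]-toMark : ∀ A → matches [] (map toMark A) ≡ true
matches-[]-toMark []          = refl
matches-[]-toMark (true ∷ A)  = matches-[]-toMark A
matches-[]-toMark (false ∷ A) = matches-[]-toMark A

FCoeff-partialSums : ∀ I A a → FCoeff I (a ∷ partialSums a A) ≡ toℕ (matches I (map toMark A))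
FCoeff-partialSums []          []          a = refl
FCoeff-partialSums (true ∷ I)  []          a = refl
FCoeff-partialSums (false ∷ I) []          a = refl
FCoeff-partialSums []          (b ∷ A)     a = cong toℕ (sym (matches-[]-toMark (b ∷ A)))
FCoeff-partialSums (true ∷ I)  (true ∷ A)  a with a <? suc a
... | yes _   = FCoeff-partialSums I A (suc a)
... | no a≮1+a = contradiction (n<1+n a) a≮1+a
FCoeff-partialSums (true ∷ I)  (false ∷ A) a with a <? a
... | yes a<a = contradiction a<a (n≮n a)
... | no _    = refl
FCoeff-partialSums (false ∷ I) (true ∷ A)  a = FCoeff-partialSums I A (suc a)
FCoeff-partialSums (false ∷ I) (false ∷ A) a = FCoeff-partialSums I A a

UCoeff-monomialRisingAt : ∀ {n} (P : Poset n) A → UCoeff P (monomialRisingAt A) ≡ countMatching P (map toMark A)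
UCoeff-monomialRisingAt {n} P A =
  trans (sum-map-listings (λ π → FCoeff (XDes P π) (monomialRisingAt A)))
        (sumLists-cong n λ π _ → cong (𝟙 (unique? π) *_) (FCoeff-partialSums (XDes P π) A 0))

-- Eliminating required positions

SameU-sym : ∀ {n} {P Q : Poset n} → SameU P Q → SameU Q P
SameU-sym same i len increasing = sym (same i len increasing)

module _ {n : ℕ} {P Q : Poset n} (same : SameU P Q) where

  SameCount : List Mark → Set
  SameCount ps = suc (length ps) ≡ n → countMatching P ps ≡ countMatching Q ps

  sameCount-toMark : ∀ A → SameCount (map toMark A)
  sameCount-toMark A len = begin
    countMatching P (map toMark A) ≡⟨ UCoeff-monomialRisingAt P A ⟨
    UCoeff P (monomialRisingAt A)  ≡⟨ same (monomialRisingAt A) degree (partialSums-weaklyIncreasing 0 A) ⟩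
    UCoeff Q (monomialRisingAt A)  ≡⟨ UCoeff-monomialRisingAt Q A ⟩
    countMatching Q (map toMark A) ∎
    where
    degree : length (monomialRisingAt A) ≡ n
    degree = trans (cong suc (trans (length-partialSums 0 A) (sym (length-map toMark A)))) len

  sameCount-after : ∀ A ps → SameCount (map toMark A ++ ps)
  sameCount-after A []       = subst SameCount (sym (++-identityʳ (map toMark A))) (sameCount-toMark A)
  sameCount-after A (p ∷ ps) = sameCount-at p
    where
    before : List Mark
    before = map toMark A

    sameCount-at-toMark : ∀ b → SameCount (before ++ toMark b ∷ ps)
    sameCount-at-toMark b = subst SameCount
      (trans (cong (_++ ps) (map-++ toMark A [ b ])) (++-assoc before [ toMark b ] ps))
      (sameCount-after (A ++ [ b ]) ps)

    sameLength : ∀ {p q} → suc (length (before ++ p ∷ ps)) ≡ n → suc (length (before ++ q ∷ ps)) ≡ n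
    sameLength = trans (cong suc (trans (length-++ before) (sym (length-++ before))))

    sameCount-at : ∀ p → SameCount (before ++ p ∷ ps)
    sameCount-at forbidden = sameCount-at-toMark false
    sameCount-at free      = sameCount-at-toMark true
    sameCount-at required len = +-cancelʳ-≡ (countMatching Q (before ++ forbidden ∷ ps)) _ _ (begin
      countMatching P (before ++ required ∷ ps) + countMatching Q (before ++ forbidden ∷ ps)
        ≡⟨ cong (countMatching P (before ++ required ∷ ps) +_) (sameCount-at-toMark false (sameLength len)) ⟨
      countMatching P (before ++ required ∷ ps) + countMatching P (before ++ forbidden ∷ ps)
        ≡⟨ countMatching-split P before ps ⟩
      countMatching P (before ++ free ∷ ps)
        ≡⟨ sameCount-at-toMark true (sameLength len) ⟩
      countMatching Q (before ++ free ∷ ps)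
        ≡⟨ countMatching-split Q before ps ⟨
      countMatching Q (before ++ required ∷ ps) + countMatching Q (before ++ forbidden ∷ ps) ∎)

  SameU⇒countMatching≡ : ∀ ps → suc (length ps) ≡ n → countMatching P ps ≡ countMatching Q ps
  SameU⇒countMatching≡ = sameCount-after []

-- Chains

chainPattern : ℕ → ℕ → List Mark
chainPattern j m = replicate j required ++ replicate m free

length-chainPattern : ∀ j m → length (chainPattern j m) ≡ j + m
length-chainPattern j m =
  trans (length-++ (replicate j required)) (cong₂ _+_ (length-replicate j) (length-replicate m))

module _ {n : ℕ} (P : Poset n) where

  open IsStrictPartialOrder (isSPO P) renaming (irrefl to <P-irrefl; trans to <P-trans)

  chainCount≡sumLists : ∀ k → chainCount P k ≡ sumLists n k (toℕ ∘ isChain P)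
  chainCount≡sumLists k = trans (count≡sum-map (isChain P) (allLists n k)) (sum-map-allLists k _)

  isChain⇒Linked : ∀ c → isChain P c ≡ true → Linked (_<P_ P) c
  isChain⇒Linked []          _     = []
  isChain⇒Linked (x ∷ [])    _     = [-]
  isChain⇒Linked (x ∷ y ∷ c) chain with _<P?_ P x y | isChain⇒Linked (y ∷ c)
  ... | yes x<y | linked = x<y ∷ linked chain
  ... | no _    | _      = contradiction chain λ ()

  isChain⇒Unique : ∀ c → isChain P c ≡ true → Unique c
  isChain⇒Unique c chain =
    AllPairs.map (λ x<y x≡y → <P-irrefl x≡y x<y) (Linked⇒AllPairs <P-trans (isChain⇒Linked c chain))

  matches-requiredPrefix : ∀ x c r →
    matches (XDes P ((x ∷ c) ++ r)) (replicate (length c) required) ≡ isChain P (x ∷ c)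
  matches-requiredPrefix x []      r = refl
  matches-requiredPrefix x (y ∷ c) r = cong (⌊ _<P?_ P x y ⌋ ∧_) (matches-requiredPrefix y c r)

  matches-chainPattern : ∀ {j} x c r m → length c ≡ j →
    matches (XDes P ((x ∷ c) ++ r)) (chainPattern j m) ≡ isChain P (x ∷ c)
  matches-chainPattern x c r m refl =
    trans (matches-++-frees _ (replicate (length c) required) m) (matches-requiredPrefix x c r)

  completions*isChain : ∀ c m → length c + m ≡ n →
    completions c m * toℕ (isChain P c) ≡ toℕ (isChain P c) * m !
  completions*isChain c m len with isChain P c in chain
  ... | true  = trans (*-identityʳ _) (trans (completions-unique m c (isChain⇒Unique c chain) len)
                                             (sym (+-identityʳ (m !))))
  ... | false = *-zeroʳ (completions c m)

  countMatching-chainPattern : ∀ j m → suc j + m ≡ n →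
    countMatching P (chainPattern j m) ≡ chainCount P (suc j) * m !
  countMatching-chainPattern j m len = begin
    sumLists n n matching
      ≡⟨ cong (λ k → sumLists n k matching) (sym len) ⟩
    sumLists n (suc j + m) matching
      ≡⟨ sumLists-++ (suc j) m matching ⟩
    sumLists n (suc j) (λ c → sumLists n m (λ r → matching (c ++ r)))
      ≡⟨ sumLists-cong (suc j) extensions ⟩
    sumLists n (suc j) (λ c → toℕ (isChain P c) * m !)
      ≡⟨ *-distribʳ-sumLists (suc j) (toℕ ∘ isChain P) (m !) ⟨
    sumLists n (suc j) (toℕ ∘ isChain P) * m !
      ≡⟨ cong (_* m !) (chainCount≡sumLists (suc j)) ⟨
    chainCount P (suc j) * m ! ∎
    where
    matching : List (Fin n) → ℕ
    matching π = 𝟙 (unique? π) * toℕ (matches (XDes P π) (chainPattern j m))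

    extensions : ∀ c → length c ≡ suc j → sumLists n m (λ r → matching (c ++ r)) ≡ toℕ (isChain P c) * m !
    extensions (x ∷ c) len-c = begin
      sumLists n m (λ r → matching ((x ∷ c) ++ r))
        ≡⟨ sumLists-cong m (λ r _ → cong (λ b → 𝟙 (unique? ((x ∷ c) ++ r)) * toℕ b)
                                        (matches-chainPattern x c r m (suc-injective len-c))) ⟩
      sumLists n m (λ r → 𝟙 (unique? ((x ∷ c) ++ r)) * toℕ (isChain P (x ∷ c)))
        ≡⟨ *-distribʳ-sumLists m (λ r → 𝟙 (unique? ((x ∷ c) ++ r))) _ ⟨
      completions (x ∷ c) m * toℕ (isChain P (x ∷ c))
        ≡⟨ completions*isChain (x ∷ c) m (trans (cong (_+ m) len-c) len) ⟩
      toℕ (isChain P (x ∷ c)) * m ! ∎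

  HasChain⇒chainCount≢0 : ∀ {k} → HasChain P k → chainCount P k ≢ 0
  HasChain⇒chainCount≢0 (c , refl , chain) = m<n⇒n≢0 (subst (0 <_) (sym (chainCount≡sumLists (length c)))
    (≤-trans (≤-reflexive (cong toℕ (sym chain))) (≤-sumLists (toℕ ∘ isChain P) c)))

  chainCount≢0⇒HasChain : ∀ k → chainCount P k ≢ 0 → HasChain P k
  chainCount≢0⇒HasChain k count≢0
    with c , len , chain≢0 ← sumLists≢0⇒∃≢0 k (toℕ ∘ isChain P) (count≢0 ∘ trans (chainCount≡sumLists k))
    = c , len , toℕ≢0⇒true chain≢0

  HasChain⇒≤n : ∀ {k} → HasChain P k → k ≤ n
  HasChain⇒≤n (c , refl , chain) = Unique⇒length≤n (isChain⇒Unique c chain)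

module _ {n : ℕ} {P Q : Poset n} (same : SameU P Q) where

  SameU⇒chainCount≡ : ∀ k → 1 ≤ k → k ≤ n → chainCount P k ≡ chainCount Q k
  SameU⇒chainCount≡ (suc j) _ k≤n = *-cancelʳ-≡ _ _ (m !) {{m !≢0}} (begin
    chainCount P (suc j) * m !         ≡⟨ countMatching-chainPattern P j m len ⟨
    countMatching P (chainPattern j m) ≡⟨ SameU⇒countMatching≡ same (chainPattern j m) pattern-length ⟩
    countMatching Q (chainPattern j m) ≡⟨ countMatching-chainPattern Q j m len ⟩
    chainCount Q (suc j) * m !         ∎)
    where
    m : ℕ
    m = n ∸ suc j
    len : suc j + m ≡ n
    len = m+[n∸m]≡n k≤n
    pattern-length : suc (length (chainPattern j m)) ≡ n
    pattern-length = trans (cong suc (length-chainPattern j m)) len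

  SameU⇒HasChain : ∀ k → HasChain P k → HasChain Q k
  SameU⇒HasChain zero    _      = [] , refl , refl
  SameU⇒HasChain (suc j) chainP = chainCount≢0⇒HasChain Q (suc j)
    (subst (_≢ 0) (SameU⇒chainCount≡ (suc j) (s≤s z≤n) (HasChain⇒≤n P chainP)) (HasChain⇒chainCount≢0 P chainP))

SameU⇒LongestChainLength : ∀ {n} {P Q : Poset n} → SameU P Q →
                           ∀ k → LongestChainLength P k → LongestChainLength Q k
SameU⇒LongestChainLength same k (chainP , noLongerP) =
  SameU⇒HasChain same k chainP , λ m k<m chainQ → noLongerP m k<m (SameU⇒HasChain (SameU-sym same) m chainQ)

mainTheorem12 : (n : ℕ) (P Q : Poset n) → SameU P Q →
    ((k : ℕ) → 1 ≤ k → k ≤ n → chainCount P k ≡ chainCount Q k)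
    × ((k : ℕ) → (LongestChainLength P k → LongestChainLength Q k)
               × (LongestChainLength Q k → LongestChainLength P k))
mainTheorem12 n P Q same =
  SameU⇒chainCount≡ same ,
  λ k → SameU⇒LongestChainLength same k , SameU⇒LongestChainLength (SameU-sym same) k
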